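{- For every integer $p\ge1$, $z(T_p^R)=p^2/2+9p/2-2$.
   Context: For $p\ge1$, let $\Sigma=\{x\}\cup\bigcup_{i=1}^p\{a_i,b_i\}$ (distinct symbols). For $i\in[1,p]$ let $A_i=a_i a_{i-1}\cdots a_1$ and $B_i=b_i b_{i-1}\cdots b_1$. Let $\mathcal{A}_p=A_pA_{p-1}\cdots A_1$ and $\mathcal{B}_p=B_1B_2\cdots B_p$, and $m_p=p(p+1)/2$. For $j\in[1,m_p-1]$ let $G_j=\mathcal{A}_p[m_p-j+1\ldots m_p]\cdot x\cdot \mathcal{B}_p[1\ldots j+1]$, and let $G_{m_p}=\mathcal{A}_p\cdot x\cdot\mathcal{B}_p$. Define $T_p=G_1G_2\cdots G_{m_p}$ and let $T_p^R$ be its reverse. The Lempel–Ziv parse of a string $w$ is the factorization $w=x_1\cdots x_z$ in which each phrase $x_j$ is the longest prefix of $x_j\cdots x_z$ having another occurrence in $w$ starting at a position $i\le|x_1\cdots x_{j-1}|$ (overlaps allowed), or a single character if no nonempty such prefix exists; $z(w)$ is the number of phrases. -}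

module Defs where

open import Data.Nat using (ℕ; zero; suc; _+_; _*_; _∸_; _≡ᵇ_)
open import Data.Bool using (Bool; true; false; if_then_else_; _∧_)
open import Data.List using (List; []; _∷_; _++_; map; concat; concatMap; take; drop; length; reverse; upTo)
open import Data.Bool.ListAction using (any)

-- The alphabet Σ = {x} ∪ {a_i, b_i}; only indices i ∈ [1,p] are used in T_p.
data Sym : Set where
  x : Sym
  a : ℕ → Sym
  b : ℕ → Sym

_=ˢ_ : Sym → Sym → Bool
x   =ˢ x   = true
a i =ˢ a j = i ≡ᵇ j
b i =ˢ b j = i ≡ᵇ j
_   =ˢ _   = false

Str : Set
Str = List Sym

desc : ℕ → List ℕ
desc zero    = []
desc (suc i) = suc i ∷ desc i

asc : ℕ → List ℕ
asc i = reverse (desc i)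

A : ℕ → Str
A i = map a (desc i)

B : ℕ → Str
B i = map b (desc i)

𝒜 : ℕ → Str
𝒜 p = concatMap A (desc p)

ℬ : ℕ → Str
ℬ p = concatMap B (asc p)

m : ℕ → ℕ
m p = (p * (p + 1)) Data.Nat./ 2

-- G_j for j ∈ [1, m_p - 1]:  𝒜_p[m_p-j+1 … m_p] · x · ℬ_p[1 … j+1]
-- (1-indexed substrings; 𝒜_p has length m_p, so the suffix is drop (m_p - j))
-- and G_{m_p} = 𝒜_p · x · ℬ_p.
G : ℕ → ℕ → Str
G p j = if j ≡ᵇ m p
        then 𝒜 p ++ x ∷ ℬ p
        else drop (m p ∸ j) (𝒜 p) ++ x ∷ take (j + 1) (ℬ p)

T : ℕ → Str
T p = concatMap (G p) (asc (m p))

TR : ℕ → Str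
TR p = reverse (T p)

-- Lempel–Ziv parse (0-indexed positions).

isPrefix : Str → Str → Bool
isPrefix []       _        = true
isPrefix (_ ∷ _)  []       = false
isPrefix (c ∷ u)  (d ∷ v)  = (c =ˢ d) ∧ isPrefix u v

-- the length-ℓ factor of w starting at position i has an occurrence in w
-- starting at some position s < i (overlaps allowed)
hasPrevOcc : Str → ℕ → ℕ → Bool
hasPrevOcc w i ℓ = any (λ s → isPrefix (take ℓ (drop i w)) (drop s w)) (upTo i)

longest : Str → ℕ → ℕ → ℕ
longest w i zero    = 1
longest w i (suc ℓ) = if hasPrevOcc w i (suc ℓ) then suc ℓ else longest w i ℓ

phraseLen : Str → ℕ → ℕ
phraseLen w i = longest w i (length w ∸ i)

-- the list of phrases; each phrase has length ≥ 1, so fuel |w| suffices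
lzGo : Str → ℕ → ℕ → List Str
lzGo w zero    i = []
lzGo w (suc f) i =
  if length w Data.Nat.≤ᵇ i
  then []
  else take (phraseLen w i) (drop i w) ∷ lzGo w f (i + phraseLen w i)

lzParse : Str → List Str
lzParse w = lzGo w (length w) 0

z : Str → ℕ
z w = length (lzParse w)

{-# OPTIONS --safe #-}
module Submission where

-- Reversing T_p turns G_{m_p} into Bs · x · As, where Bs = (b₁⋯b_p)(b₁⋯b_{p-1})⋯(b₁) and
-- As = (a₁)(a₁a₂)⋯(a₁⋯a_p), and then appends the reversals of G_{m_p - 1}, …, G₁.
-- On Bs · x · As the parse takes the p fresh letters b₁, …, b_p, then one phrase per shorter
-- run b₁⋯b_k (a prefix of the first run, not extendable because the digram b_k b₁ is new),
-- the fresh letters x and a₁, and for every later run a₁⋯a_{j+1} the copy a₁⋯a_j followed by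
-- the fresh a_{j+1}: 4p − 1 phrases.  Each remaining reversed G_j is then exactly one phrase.
-- It occurs inside the reversed G_{j+1}, and the letter after it creates a digram a_i b_k where
-- a_i and b_k stand at the same position of 𝒜_p and of the reversal of ℬ_p.  No reversed G
-- contains such a digram, since there every b precedes every a, and each earlier phrase boundary
-- carries the digram of a different position.  Hence z(T_p^R) = 4p − 1 + (m_p − 1).

open import Defs
open import Data.Nat using (ℕ; zero; suc; _+_; _*_; _∸_; _⊓_; _/_; _≤_; _<_; z≤n; s≤s; _≡ᵇ_; _≤ᵇ_)
open import Data.Nat.Properties
open import Data.Bool using (true; false) renaming (T to True)
open import Data.Bool.Properties using (T-≡; T-∧)
open import Data.List using (List; []; _∷_; _++_; [_]; _∷ʳ_; map; concat; concatMap; reverse; take; drop; length; upTo)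
open import Data.List.Properties
open import Data.List.Membership.Propositional using (_∈_; _∉_; lose; find)
open import Data.List.Membership.Propositional.Properties using (∈-++⁺ʳ; ∈-++⁻; ∈-map⁻; ∈-upTo⁺; ∈-upTo⁻)
open import Data.List.Relation.Unary.Any using (here; there)
open import Data.List.Relation.Unary.Any.Properties using (any⁺; any⁻; reverse⁻)
open import Data.List.Relation.Unary.All as All using (All; []; _∷_)
import Data.List.Relation.Unary.All.Properties as All
open import Data.List.Relation.Unary.Unique.Propositional using (Unique)
open import Data.List.Relation.Unary.AllPairs using ([]; _∷_)
import Data.List.Relation.Unary.Unique.Propositional.Properties as Unique
open import Data.Product using (∃; ∃₂; _×_; _,_; proj₁; proj₂; map₂; uncurry)
open import Data.Sum using (_⊎_; inj₁; inj₂)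
open import Data.Empty using (⊥-elim)
open import Data.Nat.Tactic.RingSolver using (solve-∀)
open import Data.Nat.DivMod using (m*n/n≡m)
open import Function using (_∘_; Equivalence)
open import Relation.Nullary using (¬_; contradiction)
open import Relation.Binary.PropositionalEquality hiding ([_])

module _ {A : Set} where

  drop-length-++ : ∀ (xs ys : List A) → drop (length xs) (xs ++ ys) ≡ ys
  drop-length-++ []       ys = refl
  drop-length-++ (_ ∷ xs) ys = drop-length-++ xs ys

  take-length-++ : ∀ (xs ys : List A) k → take (length xs + k) (xs ++ ys) ≡ xs ++ take k ys
  take-length-++ []       ys k = refl
  take-length-++ (y ∷ xs) ys k = cong (y ∷_) (take-length-++ xs ys k)

  ++-prefix : ∀ (xs ys zs ws : List A) → xs ++ ys ≡ zs ++ ws → length zs ≤ length xs →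
              ∃ λ t → xs ≡ zs ++ t
  ++-prefix xs       ys []       ws eq _         = xs , refl
  ++-prefix (y ∷ xs) ys (_ ∷ zs) ws eq (s≤s len) with ∷-injective eq
  ... | refl , eq′ = let t , xs≡ = ++-prefix xs ys zs ws eq′ len in t , cong (y ∷_) xs≡

  uncons : ∀ (xs : List A) → 0 < length xs → ∃₂ λ y ys → xs ≡ y ∷ ys
  uncons (y ∷ ys) _ = y , ys , refl

reverse-concatMap : ∀ {A B : Set} (f : A → List B) xs →
                    reverse (concatMap f xs) ≡ concatMap (reverse ∘ f) (reverse xs)
reverse-concatMap f []       = refl
reverse-concatMap f (y ∷ ys) = begin
  reverse (f y ++ concatMap f ys)                              ≡⟨ reverse-++ (f y) (concatMap f ys) ⟩
  reverse (concatMap f ys) ++ reverse (f y)                    ≡⟨ cong (_++ reverse (f y)) (reverse-concatMap f ys) ⟩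
  concatMap (reverse ∘ f) (reverse ys) ++ reverse (f y)        ≡⟨ concatMap-∷ʳ ⟨
  concatMap (reverse ∘ f) (reverse ys ∷ʳ y)                    ≡⟨ cong (concatMap (reverse ∘ f)) (unfold-reverse y ys) ⟨
  concatMap (reverse ∘ f) (reverse (y ∷ ys))                   ∎
  where
  open ≡-Reasoning
  concatMap-∷ʳ : concatMap (reverse ∘ f) (reverse ys ∷ʳ y) ≡ concatMap (reverse ∘ f) (reverse ys) ++ reverse (f y)
  concatMap-∷ʳ = trans (concatMap-++ (reverse ∘ f) (reverse ys) [ y ]) (cong (_ ++_) (++-identityʳ (reverse (f y))))

reverse-++-∷ : ∀ {A : Set} (xs : List A) y zs → reverse (xs ++ y ∷ zs) ≡ reverse zs ++ y ∷ reverse xs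
reverse-++-∷ xs y zs = trans (reverse-++ xs (y ∷ zs))
  (trans (cong (_++ reverse xs) (unfold-reverse y zs)) (++-assoc (reverse zs) [ y ] (reverse xs)))

drop-reverse : ∀ {A : Set} (xs : List A) k → drop (length xs ∸ k) (reverse xs) ≡ reverse (take k xs)
drop-reverse xs k = begin
  drop (length xs ∸ k) (reverse xs)                                  ≡⟨ cong (drop (length xs ∸ k) ∘ reverse) (take++drop≡id k xs) ⟨
  drop (length xs ∸ k) (reverse (take k xs ++ drop k xs))            ≡⟨ cong (drop (length xs ∸ k)) (reverse-++ (take k xs) (drop k xs)) ⟩
  drop (length xs ∸ k) (reverse (drop k xs) ++ reverse (take k xs))  ≡⟨ cong (λ n → drop n (reverse (drop k xs) ++ reverse (take k xs))) len ⟨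
  drop (length (reverse (drop k xs))) (reverse (drop k xs) ++ _)     ≡⟨ drop-length-++ (reverse (drop k xs)) _ ⟩
  reverse (take k xs)                                                ∎
  where
  open ≡-Reasoning
  len : length (reverse (drop k xs)) ≡ length xs ∸ k
  len = trans (length-reverse (drop k xs)) (length-drop k xs)

a-injective : ∀ {i j} → a i ≡ a j → i ≡ j
a-injective refl = refl

b-injective : ∀ {i j} → b i ≡ b j → i ≡ j
b-injective refl = refl

=ˢ-sound : ∀ c d → True (c =ˢ d) → c ≡ d
=ˢ-sound x     x     _ = refl
=ˢ-sound (a i) (a j) h = cong a (≡ᵇ⇒≡ i j h)
=ˢ-sound (b i) (b j) h = cong b (≡ᵇ⇒≡ i j h)

=ˢ-refl : ∀ c → True (c =ˢ c)
=ˢ-refl x     = _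
=ˢ-refl (a i) = ≡⇒≡ᵇ i i refl
=ˢ-refl (b i) = ≡⇒≡ᵇ i i refl

isPrefix-sound : ∀ u v → True (isPrefix u v) → ∃ λ t → v ≡ u ++ t
isPrefix-sound []      v       _ = v , refl
isPrefix-sound (c ∷ u) (d ∷ v) h with Equivalence.to T-∧ h
... | c=d , u⊑v with isPrefix-sound u v u⊑v
...   | t , refl = t , cong (_∷ _) (sym (=ˢ-sound c d c=d))

isPrefix-complete : ∀ u t → True (isPrefix u (u ++ t))
isPrefix-complete []      t = _
isPrefix-complete (c ∷ u) t = Equivalence.from T-∧ (=ˢ-refl c , isPrefix-complete u t)

-- Factors and digrams

Factor : Str → Str → Set
Factor v u = ∃₂ λ u₁ u₂ → u ≡ u₁ ++ v ++ u₂

factor-++⁻ˡ : ∀ v t {u} → Factor (v ++ t) u → Factor v u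
factor-++⁻ˡ v t (u₁ , u₂ , eq) = u₁ , t ++ u₂ , trans eq (cong (u₁ ++_) (++-assoc v t u₂))

DigramFree : Sym → Sym → Str → Set
DigramFree d c y = ∀ y₁ y₂ → y ≢ y₁ ++ d ∷ c ∷ y₂

digramFree-∉ˡ : ∀ {d c y} → d ∉ y → DigramFree d c y
digramFree-∉ˡ d∉y y₁ _ refl = d∉y (∈-++⁺ʳ y₁ (here refl))

digramFree-∉ʳ : ∀ {d c y} → c ∉ y → DigramFree d c y
digramFree-∉ʳ c∉y y₁ _ refl = c∉y (∈-++⁺ʳ y₁ (there (here refl)))

digramFree-∷ : ∀ {d c e y} → c ∉ y → DigramFree d c (e ∷ y)
digramFree-∷ c∉y []       _ refl = c∉y (here refl)
digramFree-∷ c∉y (_ ∷ y₁) _ refl = c∉y (∈-++⁺ʳ y₁ (there (here refl)))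

digramFree-∷ʳ : ∀ {d c} u → d ∉ u → DigramFree d c (u ∷ʳ d)
digramFree-∷ʳ []      _   []            _ ()
digramFree-∷ʳ []      _   (_ ∷ [])      _ ()
digramFree-∷ʳ []      _   (_ ∷ _ ∷ _)   _ ()
digramFree-∷ʳ (e ∷ u) d∉u []            _ eq = d∉u (here (sym (proj₁ (∷-injective eq))))
digramFree-∷ʳ (e ∷ u) d∉u (_ ∷ y₁)      y₂ eq = digramFree-∷ʳ u (d∉u ∘ there) y₁ y₂ (proj₂ (∷-injective eq))

digramFree-++⁺ : ∀ {d c} y {z} → DigramFree d c y → DigramFree d c z →
                 (∀ y′ z′ → y ≡ y′ ∷ʳ d → z ≢ c ∷ z′) → DigramFree d c (y ++ z)
digramFree-++⁺ []          _    free-z _        y₁       y₂ eq = free-z y₁ y₂ eq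
digramFree-++⁺ (e ∷ [])    _    _      boundary []       y₂ refl = boundary [] y₂ refl refl
digramFree-++⁺ (e ∷ _ ∷ y) free-y _    _        []       y₂ refl = free-y [] y refl
digramFree-++⁺ (e ∷ y)     free-y free-z boundary (_ ∷ y₁) y₂ eq =
  digramFree-++⁺ y (λ y₁′ y₂′ → free-y (e ∷ y₁′) y₂′ ∘ cong (e ∷_)) free-z
    (λ y′ z′ → boundary (e ∷ y′) z′ ∘ cong (e ∷_)) y₁ y₂ (proj₂ (∷-injective eq))

digramFree-++ : ∀ {d c} y {z} → d ∉ y → c ∉ z → DigramFree d c (y ++ z)
digramFree-++ y d∉y c∉z = digramFree-++⁺ y (digramFree-∉ˡ d∉y) (digramFree-∉ʳ c∉z)
  λ { y′ _ refl _ → d∉y (∈-++⁺ʳ y′ (here refl)) }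

digramFree-prefix : ∀ {d c} X {Z} y {t} → DigramFree d c X → 2 + length y ≤ length X → X ++ Z ≢ y ++ d ∷ c ∷ t
digramFree-prefix {d} {c} X {Z} y {t} free len eq = free y (proj₁ split) (trans (proj₂ split) (++-assoc y _ (proj₁ split)))
  where
  split = ++-prefix X Z (y ++ d ∷ c ∷ []) t (trans eq (sym (++-assoc y (d ∷ c ∷ []) t)))
            (subst (_≤ length X) (trans (+-comm 2 _) (sym (length-++ y))) len)

-- Lempel–Ziv phrases

hasPrevOcc-sound : ∀ w i ℓ → True (hasPrevOcc w i ℓ) →
                   ∃ λ s → s < i × ∃ λ t → drop s w ≡ take ℓ (drop i w) ++ t
hasPrevOcc-sound w i ℓ h with find (any⁻ _ (upTo i) h)
... | s , s∈ , occ = s , ∈-upTo⁻ s∈ , isPrefix-sound _ _ occ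

hasPrevOcc-complete : ∀ w i ℓ s t → s < i → drop s w ≡ take ℓ (drop i w) ++ t →
                      True (hasPrevOcc w i ℓ)
hasPrevOcc-complete w i ℓ s t s<i eq =
  any⁺ _ (lose (∈-upTo⁺ s<i) (subst (True ∘ isPrefix u) (sym eq) (isPrefix-complete u t)))
  where u = take ℓ (drop i w)

hasPrevOcc-mono : ∀ w i {ℓ ℓ′} → ℓ′ ≤ ℓ → True (hasPrevOcc w i ℓ) → True (hasPrevOcc w i ℓ′)
hasPrevOcc-mono w i {ℓ} {ℓ′} ℓ′≤ℓ h with hasPrevOcc-sound w i ℓ h
... | s , s<i , t , eq = hasPrevOcc-complete w i ℓ′ s (drop ℓ′ X ++ t) s<i (begin
  drop s w                              ≡⟨ eq ⟩
  X ++ t                                ≡⟨ cong (_++ t) (take++drop≡id ℓ′ X) ⟨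
  (take ℓ′ X ++ drop ℓ′ X) ++ t         ≡⟨ ++-assoc (take ℓ′ X) _ t ⟩
  take ℓ′ X ++ drop ℓ′ X ++ t           ≡⟨ cong (_++ drop ℓ′ X ++ t) (take-take ℓ′ ℓ (drop i w)) ⟩
  take (ℓ′ ⊓ ℓ) (drop i w) ++ drop ℓ′ X ++ t ≡⟨ cong (λ k → take k (drop i w) ++ drop ℓ′ X ++ t) (m≤n⇒m⊓n≡m ℓ′≤ℓ) ⟩
  take ℓ′ (drop i w) ++ drop ℓ′ X ++ t  ∎)
  where
  open ≡-Reasoning
  X = take ℓ (drop i w)

longest-≥1 : ∀ w i n → 1 ≤ longest w i n
longest-≥1 w i zero    = s≤s z≤n
longest-≥1 w i (suc n) with hasPrevOcc w i (suc n)
... | true  = s≤s z≤n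
... | false = longest-≥1 w i n

longest-≡ : ∀ w i n {L} → 1 ≤ L → L ≤ n → L ≡ 1 ⊎ True (hasPrevOcc w i L) →
            (∀ {ℓ} → L < ℓ → ℓ ≤ n → ¬ True (hasPrevOcc w i ℓ)) → longest w i n ≡ L
longest-≡ w i zero    1≤L L≤0 _ _ = contradiction (≤-trans 1≤L L≤0) λ ()
longest-≡ w i (suc n) 1≤L L≤n occ maximal
  with m≤n⇒m<n∨m≡n L≤n | hasPrevOcc w i (suc n) in eq
... | inj₁ L<n  | true  = contradiction (Equivalence.from T-≡ eq) (maximal L<n ≤-refl)
... | inj₁ L<n  | false = longest-≡ w i n 1≤L (≤-pred L<n) occ (λ L<ℓ ℓ≤n → maximal L<ℓ (m≤n⇒m≤1+n ℓ≤n))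
... | inj₂ refl | true  = refl
... | inj₂ refl | false with occ
...   | inj₁ refl = refl
...   | inj₂ h    = ⊥-elim (subst True eq h)

hasPrevOcc-factor : ∀ {u V} r → 1 ≤ length V → Factor V u → True (hasPrevOcc (u ++ V ++ r) (length u) (length V))
hasPrevOcc-factor {V = V} r 1≤V (u₁ , u₂ , refl) =
  hasPrevOcc-complete w (length u) (length V) (length u₁) (u₂ ++ V ++ r) s<i (begin
    drop (length u₁) ((u₁ ++ V ++ u₂) ++ V ++ r) ≡⟨ cong (drop (length u₁)) (++-assoc u₁ (V ++ u₂) (V ++ r)) ⟩
    drop (length u₁) (u₁ ++ (V ++ u₂) ++ V ++ r) ≡⟨ drop-length-++ u₁ _ ⟩
    (V ++ u₂) ++ V ++ r                          ≡⟨ ++-assoc V u₂ (V ++ r) ⟩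
    V ++ u₂ ++ V ++ r                            ≡⟨ cong (_++ u₂ ++ V ++ r) take-V ⟨
    take (length V) (drop (length u) w) ++ u₂ ++ V ++ r ∎)
  where
  open ≡-Reasoning
  u = u₁ ++ V ++ u₂
  w = u ++ V ++ r
  s<i : length u₁ < length u
  s<i = subst (length u₁ <_) (sym (length-++ u₁)) (m<m+n (length u₁) (≤-trans 1≤V (length-++-≤ˡ V)))
  take-V : take (length V) (drop (length u) w) ≡ V
  take-V = begin
    take (length V) (drop (length u) w)  ≡⟨ cong (take (length V)) (drop-length-++ u (V ++ r)) ⟩
    take (length V) (V ++ r)             ≡⟨ cong (λ k → take k (V ++ r)) (+-identityʳ (length V)) ⟨
    take (length V + 0) (V ++ r)         ≡⟨ take-length-++ V r 0 ⟩
    V ++ []                              ≡⟨ ++-identityʳ V ⟩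
    V                                    ∎

-- An earlier occurrence of (v ∷ʳ d) ∷ʳ c starts inside u, so its digram d c lies inside u ++ v ∷ʳ d.
¬hasPrevOcc-extension : ∀ {u v d c r} → DigramFree d c (u ++ v ∷ʳ d) →
                        ¬ True (hasPrevOcc (u ++ (v ∷ʳ d) ++ c ∷ r) (length u) (suc (length (v ∷ʳ d))))
¬hasPrevOcc-extension {u} {v} {d} {c} {r} free occ = refute (hasPrevOcc-sound w (length u) (suc L) occ)
  where
  V = v ∷ʳ d
  L = length V
  w = u ++ V ++ c ∷ r
  next : take (suc L) (drop (length u) w) ≡ V ∷ʳ c
  next = begin
    take (suc L) (drop (length u) w)  ≡⟨ cong (take (suc L)) (drop-length-++ u _) ⟩
    take (suc L) (V ++ c ∷ r)         ≡⟨ cong (λ k → take k (V ++ c ∷ r)) (+-comm 1 L) ⟩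
    take (L + 1) (V ++ c ∷ r)         ≡⟨ take-length-++ V (c ∷ r) 1 ⟩
    V ∷ʳ c                            ∎
    where open ≡-Reasoning
  refute : ¬ ∃ λ s → s < length u × ∃ λ t → drop s w ≡ take (suc L) (drop (length u) w) ++ t
  refute (s , s<i , t , eq) = digramFree-prefix (u ++ V) (take s w ++ v) free bound split
    where
    split : (u ++ V) ++ c ∷ r ≡ (take s w ++ v) ++ d ∷ c ∷ t
    split = begin
      (u ++ V) ++ c ∷ r              ≡⟨ ++-assoc u V (c ∷ r) ⟩
      w                              ≡⟨ take++drop≡id s w ⟨
      take s w ++ drop s w           ≡⟨ cong (take s w ++_) (trans eq (cong (_++ t) next)) ⟩
      take s w ++ (V ∷ʳ c) ++ t      ≡⟨ cong (take s w ++_) (trans (++-assoc V [ c ] t) (++-assoc v [ d ] (c ∷ t))) ⟩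
      take s w ++ v ++ d ∷ c ∷ t     ≡⟨ ++-assoc (take s w) v (d ∷ c ∷ t) ⟨
      (take s w ++ v) ++ d ∷ c ∷ t   ∎
      where open ≡-Reasoning
    bound : 2 + length (take s w ++ v) ≤ length (u ++ V)
    bound = begin
      2 + length (take s w ++ v)           ≡⟨ cong (2 +_) (length-++ (take s w)) ⟩
      2 + (length (take s w) + length v)   ≤⟨ +-monoʳ-≤ 2 (+-monoˡ-≤ (length v) (subst (_≤ s) (sym (length-take s w)) (m⊓n≤m s _))) ⟩
      2 + (s + length v)                   ≡⟨ shift s (length v) ⟩
      suc s + (length v + 1)               ≤⟨ +-monoˡ-≤ (length v + 1) s<i ⟩
      length u + (length v + 1)            ≡⟨ cong (length u +_) (length-++ v) ⟨
      length u + L                         ≡⟨ length-++ u ⟨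
      length (u ++ V)                      ∎
      where
      open ≤-Reasoning
      shift : ∀ m n → 2 + (m + n) ≡ suc m + (n + 1)
      shift = solve-∀

phraseLen-≡ : ∀ {w u v d r} → w ≡ u ++ (v ∷ʳ d) ++ r → v ≡ [] ⊎ Factor (v ∷ʳ d) u →
              (∀ {c r′} → r ≡ c ∷ r′ → DigramFree d c (u ++ v ∷ʳ d)) →
              phraseLen w (length u) ≡ length (v ∷ʳ d)
phraseLen-≡ {u = u} {v} {d} {r} refl occ free =
  longest-≡ w i (length w ∸ i) 1≤L L≤n (occurs occ) maximal
  where
  V = v ∷ʳ d
  w = u ++ V ++ r
  i = length u
  L = length V
  n≡ : length w ∸ i ≡ L + length r
  n≡ = trans (cong (_∸ i) (trans (length-++ u) (cong (i +_) (length-++ V)))) (m+n∸m≡n i _)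
  1≤L : 1 ≤ L
  1≤L = subst (1 ≤_) (sym (trans (length-++ v) (+-comm (length v) 1))) (s≤s z≤n)
  L≤n : L ≤ length w ∸ i
  L≤n = subst (L ≤_) (sym n≡) (m≤m+n L _)
  occurs : v ≡ [] ⊎ Factor V u → L ≡ 1 ⊎ True (hasPrevOcc w i L)
  occurs (inj₁ refl)   = inj₁ refl
  occurs (inj₂ factor) = inj₂ (hasPrevOcc-factor r 1≤L factor)
  maximal : ∀ {ℓ} → L < ℓ → ℓ ≤ length w ∸ i → ¬ True (hasPrevOcc w i ℓ)
  maximal {ℓ} L<ℓ ℓ≤n occ = ¬hasPrevOcc-extension {u} {v} {d} (free r≡)
    (subst (λ r → True (hasPrevOcc (u ++ V ++ r) i (suc L))) r≡ (hasPrevOcc-mono w i L<ℓ occ))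
    where
    r-nonempty : 0 < length r
    r-nonempty = +-cancelˡ-< L 0 (length r)
      (subst (_< L + length r) (sym (+-identityʳ L)) (<-≤-trans L<ℓ (≤-trans ℓ≤n (≤-reflexive n≡))))
    r≡ = proj₂ (proj₂ (uncons r r-nonempty))

data LZFrom (w : Str) : ℕ → ℕ → Set where
  done : LZFrom w (length w) 0
  step : ∀ {i n} → i < length w → LZFrom w (i + phraseLen w i) n → LZFrom w i (suc n)

phraseLen-≥1 : ∀ w i → 1 ≤ phraseLen w i
phraseLen-≥1 w i = longest-≥1 w i (length w ∸ i)

lzGo-length : ∀ {w i n} → LZFrom w i n → ∀ f → length w ≤ f + i → length (lzGo w f i) ≡ n
lzGo-length done zero    _ = refl
lzGo-length {w} done (suc f) _ rewrite Equivalence.to T-≡ (≤⇒≤ᵇ (≤-refl {length w})) = refl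
lzGo-length (step i<w _) zero w≤i = contradiction w≤i (<⇒≱ i<w)
lzGo-length {w} {i} (step i<w rest) (suc f) w≤f+i with length w ≤ᵇ i in eq
... | true  = contradiction (≤ᵇ⇒≤ _ _ (Equivalence.from T-≡ eq)) (<⇒≱ i<w)
... | false = cong suc (lzGo-length rest f (begin
  length w               ≤⟨ w≤f+i ⟩
  suc f + i              ≡⟨ +-suc f i ⟨
  f + suc i              ≤⟨ +-monoʳ-≤ f (subst (_≤ i + phraseLen w i) (+-comm i 1) (+-monoʳ-≤ i (phraseLen-≥1 w i))) ⟩
  f + (i + phraseLen w i) ∎))
  where open ≤-Reasoning

z-≡ : ∀ {w n} → LZFrom w 0 n → z w ≡ n
z-≡ {w} parse = lzGo-length parse (length w) (≤-reflexive (sym (+-identityʳ (length w))))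

phrase : ∀ {w u V r n} v d → V ≡ v ∷ʳ d → w ≡ u ++ V ++ r → v ≡ [] ⊎ Factor V u →
         (∀ {c r′} → r ≡ c ∷ r′ → DigramFree d c (u ++ V)) →
         LZFrom w (length (u ++ V)) n → LZFrom w (length u) (suc n)
phrase {w} {u} {V} {r} {n} v d refl refl occ free rest = step u<w (subst (λ i → LZFrom w i n) next rest)
  where
  len≡ : phraseLen w (length u) ≡ length V
  len≡ = phraseLen-≡ {w} refl occ free
  next : length (u ++ V) ≡ length u + phraseLen w (length u)
  next = trans (length-++ u) (cong (length u +_) (sym len≡))
  u<w : length u < length w
  u<w = subst (length u <_) (sym (length-++ u))
          (m<m+n (length u) (≤-trans (subst (1 ≤_) len≡ (phraseLen-≥1 w (length u))) (length-++-≤ˡ V)))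

fresh-phrase : ∀ {w u d r n} → w ≡ u ++ d ∷ r → d ∉ u →
               LZFrom w (length (u ∷ʳ d)) n → LZFrom w (length u) (suc n)
fresh-phrase {u = u} {d} w≡ d∉u = phrase [] d refl w≡ (inj₁ refl) (λ _ → digramFree-∷ʳ u d∉u)

-- Runs c₁ c₂ ⋯ c_r

∈-desc : ∀ {i} n → i ∈ desc n → 1 ≤ i × i ≤ n
∈-desc (suc n) (here refl) = s≤s z≤n , ≤-refl
∈-desc (suc n) (there i∈)  = map₂ m≤n⇒m≤1+n (∈-desc n i∈)

∈-asc : ∀ {i} n → i ∈ asc n → 1 ≤ i × i ≤ n
∈-asc n = ∈-desc n ∘ reverse⁻

concatMap-cong-desc : ∀ {B : Set} {f g : ℕ → List B} n → (∀ {j} → 1 ≤ j → j ≤ n → f j ≡ g j) →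
                      concatMap f (desc n) ≡ concatMap g (desc n)
concatMap-cong-desc n f≡g = cong concat (map-cong-local (All.tabulate (uncurry f≡g ∘ ∈-desc n)))

asc-∷ʳ : ∀ n → asc (suc n) ≡ asc n ∷ʳ suc n
asc-∷ʳ n = unfold-reverse (suc n) (desc n)

asc-∷ : ∀ n → asc (suc n) ≡ 1 ∷ map suc (asc n)
asc-∷ zero    = refl
asc-∷ (suc n) = begin
  asc (suc (suc n))                      ≡⟨ asc-∷ʳ (suc n) ⟩
  asc (suc n) ∷ʳ suc (suc n)             ≡⟨ cong (_∷ʳ suc (suc n)) (asc-∷ n) ⟩
  1 ∷ map suc (asc n) ∷ʳ suc (suc n)     ≡⟨ cong (1 ∷_) (map-++ suc (asc n) [ suc n ]) ⟨
  1 ∷ map suc (asc n ∷ʳ suc n)           ≡⟨ cong (λ ns → 1 ∷ map suc ns) (asc-∷ʳ n) ⟨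
  1 ∷ map suc (asc (suc n))              ∎
  where open ≡-Reasoning

asc-prefix : ∀ {k} q → k ≤ q → ∃ λ ks → asc q ≡ asc k ++ ks
asc-prefix zero    z≤n = [] , refl
asc-prefix (suc q) k≤q with m≤n⇒m<n∨m≡n k≤q
... | inj₂ refl = [] , sym (++-identityʳ _)
... | inj₁ k<q  with ks , eq ← asc-prefix q (≤-pred k<q) =
  ks ∷ʳ suc q , trans (asc-∷ʳ q) (trans (cong (_∷ʳ suc q) eq) (++-assoc _ ks [ suc q ]))

run : (ℕ → Sym) → ℕ → Str
run c r = map c (asc r)

runs : (ℕ → Sym) → List ℕ → Str
runs c = concatMap (run c)

module _ (c : ℕ → Sym) where

  run-∷ʳ : ∀ r → run c (suc r) ≡ run c r ∷ʳ c (suc r)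
  run-∷ʳ r = trans (cong (map c) (asc-∷ʳ r)) (map-++ c (asc r) [ suc r ])

  run-∷ : ∀ r → run c (suc r) ≡ c 1 ∷ map c (map suc (asc r))
  run-∷ r = cong (map c) (asc-∷ r)

  runs-∷ʳ : ∀ qs k → runs c (qs ∷ʳ k) ≡ runs c qs ++ run c k
  runs-∷ʳ qs k = trans (concatMap-++ (run c) qs [ k ]) (cong (runs c qs ++_) (++-identityʳ (run c k)))

  runs-asc-∷ʳ : ∀ q → runs c (asc (suc q)) ≡ runs c (asc q) ++ run c (suc q)
  runs-asc-∷ʳ q = trans (cong (runs c) (asc-∷ʳ q)) (runs-∷ʳ (asc q) (suc q))

  run-prefix : ∀ {k q} → k ≤ q → ∃ λ t → run c q ≡ run c k ++ t
  run-prefix {k} {q} k≤q with ks , eq ← asc-prefix q k≤q = map c ks , trans (cong (map c) eq) (map-++ c (asc k) ks)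

  runs-asc-prefix : ∀ {k q} → k ≤ q → ∃ λ t → runs c (asc q) ≡ runs c (asc k) ++ t
  runs-asc-prefix {k} {q} k≤q with ks , eq ← asc-prefix q k≤q =
    runs c ks , trans (cong (runs c) eq) (concatMap-++ (run c) (asc k) ks)

  ∉-map : ∀ {s} → (∀ i → s ≢ c i) → ∀ is → s ∉ map c is
  ∉-map s≢c is s∈ with ∈-map⁻ c s∈
  ... | i , _ , refl = s≢c i refl

  ∉-runs : ∀ {s} → (∀ i → s ≢ c i) → ∀ qs → s ∉ runs c qs
  ∉-runs s≢c qs = ∉-map s≢c (concatMap asc qs) ∘ subst (_ ∈_) (sym (map-concatMap c asc qs))

module _ (c : ℕ → Sym) (c-injective : ∀ {i j} → c i ≡ c j → i ≡ j) where

  ∉-run : ∀ {i} r → r < i → c i ∉ run c r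
  ∉-run r r<i ci∈ with ∈-map⁻ c ci∈
  ... | j , j∈ , ci≡cj = <⇒≱ r<i (subst (_≤ r) (sym (c-injective ci≡cj)) (proj₂ (∈-asc r j∈)))

  ∉-runs-asc : ∀ {i} q → q < i → c i ∉ runs c (asc q)
  ∉-runs-asc zero    _   ()
  ∉-runs-asc (suc q) q<i ci∈ with ∈-++⁻ (runs c (asc q)) (subst (_ ∈_) (runs-asc-∷ʳ c q) ci∈)
  ... | inj₁ ci∈runs = ∉-runs-asc q (<-trans (n<1+n q) q<i) ci∈runs
  ... | inj₂ ci∈run  = ∉-run (suc q) q<i ci∈run

  run-last : ∀ {k} q y → run c q ≡ y ∷ʳ c k → q ≡ k
  run-last zero    []      ()
  run-last zero    (_ ∷ _) ()
  run-last (suc q) y eq = c-injective (∷ʳ-injectiveʳ (run c q) y (trans (sym (run-∷ʳ c q)) eq))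

  run-digramFree : ∀ {d} r → DigramFree d (c 1) (run c r)
  run-digramFree zero    = digramFree-∉ʳ λ ()
  run-digramFree (suc r) rewrite run-∷ c r = digramFree-∷ c1∉
    where
    c1∉ : c 1 ∉ map c (map suc (asc r))
    c1∉ c1∈ with ∈-map⁻ c c1∈
    ... | _ , j∈ , c1≡cj with ∈-map⁻ suc j∈
    ...   | i , i∈ , refl with c-injective c1≡cj | ∈-asc r i∈
    ...     | refl | () , _

  -- In runs c qs ++ run c k the letter c 1 follows c k only where a run of length k ends.
  runs-digramFree : ∀ {k} qs → All (k ≢_) qs → DigramFree (c k) (c 1) (runs c qs ++ run c k)
  runs-digramFree {k} []       _          = run-digramFree k
  runs-digramFree {k} (q ∷ qs) (k≢q ∷ k∉) =
    subst (DigramFree (c k) (c 1)) (sym (++-assoc (run c q) (runs c qs) (run c k)))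
      (digramFree-++⁺ (run c q) (run-digramFree q) (runs-digramFree qs k∉)
        λ y′ _ eq _ → k≢q (sym (run-last q y′ eq)))

  run-parse : ∀ {w r n} q → w ≡ run c q ++ r → LZFrom w (length (run c q)) n → LZFrom w 0 (q + n)
  run-parse zero    _  rest = rest
  run-parse {w} {r} {n} (suc q) w≡ rest =
    subst (LZFrom w 0) (+-suc q n) (run-parse q w≡′
      (fresh-phrase w≡′ (∉-run q ≤-refl) (subst (λ i → LZFrom w i n) (cong length (run-∷ʳ c q)) rest)))
    where
    w≡′ : w ≡ run c q ++ c (suc q) ∷ r
    w≡′ = trans w≡ (trans (cong (_++ r) (run-∷ʳ c q)) (++-assoc (run c q) [ c (suc q) ] r))

  descending-runs-parse : ∀ {w sep r n} → (∀ i → sep ≢ c i) → ∀ k q qs →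
                 w ≡ runs c (q ∷ qs) ++ runs c (desc k) ++ sep ∷ r → All (k <_) (q ∷ qs) →
                 LZFrom w (length (runs c (q ∷ qs ++ desc k))) n → LZFrom w (length (runs c (q ∷ qs))) (k + n)
  descending-runs-parse {w} {n = n} _ zero q qs _ _ rest =
    subst (λ i → LZFrom w i n) (cong (length ∘ runs c ∘ (q ∷_)) (++-identityʳ qs)) rest
  descending-runs-parse {w} {sep} {r} {n} sep≢c (suc k) q qs w≡ k<qs rest =
    phrase (run c k) (c (suc k)) (run-∷ʳ c k) w≡′ (inj₂ factor) (next-free k k<qs)
      (subst (λ i → LZFrom w i (k + n)) (cong length (runs-∷ʳ c (q ∷ qs) (suc k)))
        (descending-runs-parse sep≢c k q (qs ∷ʳ suc k) w≡″ (All.∷ʳ⁺ (All.map (<-trans (n<1+n k)) k<qs) (n<1+n k))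
          (subst (λ i → LZFrom w (length (runs c (q ∷ i))) n) (sym (++-assoc qs [ suc k ] (desc k))) rest)))
    where
    u = runs c (q ∷ qs)
    V = run c (suc k)
    w≡′ : w ≡ u ++ V ++ (runs c (desc k) ++ sep ∷ r)
    w≡′ = trans w≡ (cong (u ++_) (++-assoc V (runs c (desc k)) (sep ∷ r)))
    w≡″ : w ≡ runs c (q ∷ qs ∷ʳ suc k) ++ runs c (desc k) ++ sep ∷ r
    w≡″ = trans w≡′ (trans (sym (++-assoc u V _)) (cong (_++ _) (sym (runs-∷ʳ c (q ∷ qs) (suc k)))))
    factor : Factor V u
    factor with t , eq ← run-prefix c (<⇒≤ (All.head k<qs)) =
      [] , t ++ runs c qs , trans (cong (_++ runs c qs) eq) (++-assoc V t (runs c qs))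
    next-free : ∀ j → All (suc j <_) (q ∷ qs) → ∀ {d r′} → runs c (desc j) ++ sep ∷ r ≡ d ∷ r′ →
                DigramFree (c (suc j)) d (u ++ run c (suc j))
    next-free zero     _     eq = subst (λ s → DigramFree (c 1) s (u ++ run c 1)) (proj₁ (∷-injective eq))
      (digramFree-∉ʳ (subst (sep ∉_) (runs-∷ʳ c (q ∷ qs) 1) (∉-runs c sep≢c (q ∷ qs ∷ʳ 1))))
    next-free (suc j) j<qs eq = subst (λ s → DigramFree (c (suc (suc j))) s (u ++ run c (suc (suc j))))
      (proj₁ (∷-injective (trans (cong (λ h → (h ++ runs c (desc j)) ++ sep ∷ r) (sym (run-∷ c j))) eq)))
      (runs-digramFree (q ∷ qs) (All.map (λ j<q j≡q → <-irrefl j≡q j<q) j<qs))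

  ascending-run-parse : ∀ {w u r n} j → (∀ i → c i ∉ u) → w ≡ (u ++ runs c (asc (suc (suc j)))) ++ r →
                        LZFrom w (length (u ++ runs c (asc (suc (suc j))))) n →
                        LZFrom w (length (u ++ runs c (asc (suc j)))) (2 + n)
  ascending-run-parse {w} {u} {r} {n} j c∉u w≡ rest =
    phrase (run c j) (c (suc j)) (run-∷ʳ c j) w≡₁ (inj₂ factor) (λ eq → digramFree-∉ʳ (subst (_∉ U ++ V) (proj₁ (∷-injective eq)) fresh))
      (fresh-phrase w≡₂ fresh (subst (λ i → LZFrom w i n) (cong length grow) rest))
    where
    open ≡-Reasoning
    R = runs c (asc (suc j))
    U = u ++ R
    V = run c (suc j)
    d = c (suc (suc j))
    grow : u ++ runs c (asc (suc (suc j))) ≡ (U ++ V) ∷ʳ d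
    grow = begin
      u ++ runs c (asc (suc (suc j)))   ≡⟨ cong (u ++_) (runs-asc-∷ʳ c (suc j)) ⟩
      u ++ R ++ run c (suc (suc j))     ≡⟨ cong (λ t → u ++ R ++ t) (run-∷ʳ c (suc j)) ⟩
      u ++ R ++ (V ∷ʳ d)                ≡⟨ ++-assoc u R (V ∷ʳ d) ⟨
      U ++ (V ∷ʳ d)                     ≡⟨ ++-assoc U V [ d ] ⟨
      (U ++ V) ∷ʳ d                     ∎
    w≡₂ : w ≡ (U ++ V) ++ d ∷ r
    w≡₂ = trans w≡ (trans (cong (_++ r) grow) (∷ʳ-++ (U ++ V) d r))
    w≡₁ : w ≡ U ++ V ++ d ∷ r
    w≡₁ = trans w≡₂ (++-assoc U V (d ∷ r))
    factor : Factor V U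
    factor = u ++ runs c (asc j) , [] ,
      trans (cong (u ++_) (runs-asc-∷ʳ c j)) (trans (sym (++-assoc u (runs c (asc j)) V)) (cong ((u ++ runs c (asc j)) ++_) (sym (++-identityʳ V))))
    fresh : d ∉ U ++ V
    fresh d∈ with ∈-++⁻ u (subst (d ∈_) (++-assoc u R V) d∈)
    ... | inj₁ d∈u = c∉u (suc (suc j)) d∈u
    ... | inj₂ d∈RV with ∈-++⁻ R d∈RV
    ...   | inj₁ d∈R = ∉-runs-asc (suc j) ≤-refl d∈R
    ...   | inj₂ d∈V = ∉-run (suc j) ≤-refl d∈V

  ascending-runs-parse : ∀ {w u r n} q → (∀ i → c i ∉ u) → w ≡ u ++ runs c (asc q) ++ r →
                         LZFrom w (length (u ++ runs c (asc q))) n →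
                         ∀ d {j} → suc j + d ≡ q → LZFrom w (length (u ++ runs c (asc (suc j)))) (d * 2 + n)
  ascending-runs-parse {w} {u} {n = n} q _ _ rest zero {j} eq =
    subst (λ k → LZFrom w (length (u ++ runs c (asc k))) n) (trans (sym eq) (+-identityʳ (suc j))) rest
  ascending-runs-parse {w} {u} {r} q c∉u w≡ rest (suc d) {j} eq =
    ascending-run-parse j c∉u w≡′ (ascending-runs-parse q c∉u w≡ rest d eq′)
    where
    eq′ : suc (suc j) + d ≡ q
    eq′ = trans (sym (+-suc (suc j) d)) eq
    prefix = runs-asc-prefix c (subst (suc (suc j) ≤_) eq′ (m≤m+n (suc (suc j)) d))
    w≡′ : w ≡ (u ++ runs c (asc (suc (suc j)))) ++ proj₁ prefix ++ r
    w≡′ = trans w≡ (trans (cong (λ t → u ++ t ++ r) (proj₂ prefix))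
            (trans (cong (u ++_) (++-assoc (runs c (asc (suc (suc j)))) (proj₁ prefix) r))
                   (sym (++-assoc u (runs c (asc (suc (suc j)))) _))))

-- Cells

-- A cell (i , j) stands for the letters a_i and b_j at one and the same position of 𝒜_p and of
-- the reversal of ℬ_p; cells p lists these positions in order (map-aᶜ-cells, reverse-ℬ).
Cell : Set
Cell = ℕ × ℕ

aᶜ bᶜ : Cell → Sym
aᶜ = a ∘ proj₁
bᶜ = b ∘ proj₂

diagonal : ℕ → ℕ → List Cell
diagonal zero    s = []
diagonal (suc n) s = (suc n , s) ∷ diagonal n (suc s)

cells : ℕ → List Cell
cells p = concatMap (λ r → diagonal r 1) (desc p)

-- Gʳ (cells p) is G_{m_p} reversed, and for a suffix e ∷ S of cells p the string bᶜ e ∷ Gʳ S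
-- is G_{length S} reversed; so chain (cells p) is the reversal of G₁ ⋯ G_{m_p - 1} (TR-cells).
Gʳ : List Cell → Str
Gʳ S = map bᶜ S ++ x ∷ reverse (map aᶜ S)

chain : List Cell → Str
chain []          = []
chain (_ ∷ [])    = []
chain (e ∷ f ∷ S) = (bᶜ e ∷ Gʳ (f ∷ S)) ++ chain (f ∷ S)

length-diagonal : ∀ n s → length (diagonal n s) ≡ n
length-diagonal zero    s = refl
length-diagonal (suc n) s = cong suc (length-diagonal n (suc s))

map-proj₁-diagonal : ∀ n s → map proj₁ (diagonal n s) ≡ desc n
map-proj₁-diagonal zero    s = refl
map-proj₁-diagonal (suc n) s = cong (suc n ∷_) (map-proj₁-diagonal n (suc s))

map-proj₂-diagonal-suc : ∀ n s → map proj₂ (diagonal n (suc s)) ≡ map suc (map proj₂ (diagonal n s))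
map-proj₂-diagonal-suc zero    s = refl
map-proj₂-diagonal-suc (suc n) s = cong (suc s ∷_) (map-proj₂-diagonal-suc n (suc s))

map-proj₂-diagonal : ∀ n → map proj₂ (diagonal n 1) ≡ asc n
map-proj₂-diagonal zero    = refl
map-proj₂-diagonal (suc n) = begin
  1 ∷ map proj₂ (diagonal n 2)          ≡⟨ cong (1 ∷_) (map-proj₂-diagonal-suc n 1) ⟩
  1 ∷ map suc (map proj₂ (diagonal n 1)) ≡⟨ cong (λ ns → 1 ∷ map suc ns) (map-proj₂-diagonal n) ⟩
  1 ∷ map suc (asc n)                   ≡⟨ asc-∷ n ⟨
  asc (suc n)                           ∎
  where open ≡-Reasoning

length-cells : ∀ p → length (cells p) * 2 ≡ p * (p + 1)
length-cells zero    = refl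
length-cells (suc p) = begin
  length (diagonal (suc p) 1 ++ cells p) * 2        ≡⟨ cong (_* 2) (length-++ (diagonal (suc p) 1)) ⟩
  (length (diagonal (suc p) 1) + length (cells p)) * 2 ≡⟨ cong (λ n → (n + length (cells p)) * 2) (length-diagonal (suc p) 1) ⟩
  (suc p + length (cells p)) * 2                    ≡⟨ *-distribʳ-+ 2 (suc p) (length (cells p)) ⟩
  suc p * 2 + length (cells p) * 2                  ≡⟨ cong (suc p * 2 +_) (length-cells p) ⟩
  suc p * 2 + p * (p + 1)                           ≡⟨ square p ⟩
  suc p * (suc p + 1)                               ∎
  where
  open ≡-Reasoning
  square : ∀ p → suc p * 2 + p * (p + 1) ≡ suc p * (suc p + 1)
  square = solve-∀

reverse-runs : ∀ c ps → reverse (concatMap (map c ∘ desc) ps) ≡ runs c (reverse ps)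
reverse-runs c ps = trans (reverse-concatMap (map c ∘ desc) ps)
                      (concatMap-cong (λ r → sym (reverse-map c (desc r))) (reverse ps))

map-bᶜ-cells : ∀ p → map bᶜ (cells p) ≡ runs b (desc p)
map-bᶜ-cells p = trans (map-concatMap bᶜ (λ r → diagonal r 1) (desc p))
  (concatMap-cong (λ r → trans (map-∘ (diagonal r 1)) (cong (map b) (map-proj₂-diagonal r))) (desc p))

map-aᶜ-cells : ∀ p → map aᶜ (cells p) ≡ 𝒜 p
map-aᶜ-cells p = trans (map-concatMap aᶜ (λ r → diagonal r 1) (desc p))
  (concatMap-cong (λ r → trans (map-∘ (diagonal r 1)) (cong (map a) (map-proj₁-diagonal r 1))) (desc p))

reverse-ℬ : ∀ p → reverse (ℬ p) ≡ map bᶜ (cells p)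
reverse-ℬ p = begin
  reverse (ℬ p)                       ≡⟨ reverse-runs b (asc p) ⟩
  runs b (reverse (asc p))            ≡⟨ cong (runs b) (reverse-involutive (desc p)) ⟩
  runs b (desc p)                     ≡⟨ map-bᶜ-cells p ⟨
  map bᶜ (cells p)                    ∎
  where open ≡-Reasoning

reverse-map-aᶜ-cells : ∀ p → reverse (map aᶜ (cells p)) ≡ runs a (asc p)
reverse-map-aᶜ-cells p = trans (cong reverse (map-aᶜ-cells p)) (reverse-runs a (desc p))

diagonal-proj₂-≥ : ∀ n s → All (λ e → s ≤ proj₂ e) (diagonal n s)
diagonal-proj₂-≥ zero    s = []
diagonal-proj₂-≥ (suc n) s = ≤-refl ∷ All.map (≤-trans (n≤1+n s)) (diagonal-proj₂-≥ n (suc s))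

diagonal-sum : ∀ n s → All (λ e → proj₁ e + proj₂ e ≡ n + s) (diagonal n s)
diagonal-sum zero    s = []
diagonal-sum (suc n) s = refl ∷ All.map (λ eq → trans eq (+-suc n s)) (diagonal-sum n (suc s))

cells-sum-≤ : ∀ p → All (λ e → proj₁ e + proj₂ e ≤ p + 1) (cells p)
cells-sum-≤ zero    = []
cells-sum-≤ (suc p) = All.++⁺ (All.map ≤-reflexive (diagonal-sum (suc p) 1)) (All.map m≤n⇒m≤1+n (cells-sum-≤ p))

unique-diagonal : ∀ n s → Unique (diagonal n s)
unique-diagonal zero    s = []
unique-diagonal (suc n) s =
  All.map (λ s<j eq → <-irrefl (cong proj₂ eq) s<j) (diagonal-proj₂-≥ n (suc s)) ∷ unique-diagonal n (suc s)

unique-cells : ∀ p → Unique (cells p)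
unique-cells zero    = []
unique-cells (suc p) = Unique.++⁺ (unique-diagonal (suc p) 1) (unique-cells p) λ (e∈diagonal , e∈cells) →
  1+n≰n (subst (_≤ p + 1) (All.lookup (diagonal-sum (suc p) 1) e∈diagonal) (All.lookup (cells-sum-≤ p) e∈cells))

cell-≡ : ∀ {e g} → aᶜ e ≡ aᶜ g → bᶜ e ≡ bᶜ g → e ≡ g
cell-≡ refl refl = refl

Gʳ-digramFree : ∀ e S S′ → DigramFree (aᶜ e) (bᶜ e) (map bᶜ S ++ x ∷ reverse (map aᶜ S′))
Gʳ-digramFree e S S′ = digramFree-++ (map bᶜ S) a∉ b∉
  where
  a∉ : aᶜ e ∉ map bᶜ S
  a∉ a∈ with ∈-map⁻ bᶜ a∈
  ... | _ , _ , ()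
  b∉ : bᶜ e ∉ x ∷ reverse (map aᶜ S′)
  b∉ (there b∈) with ∈-map⁻ aᶜ (reverse⁻ {xs = map aᶜ S′} b∈)
  ... | _ , _ , ()

Gʳ-∷ : ∀ e S → Gʳ (e ∷ S) ≡ (map bᶜ (e ∷ S) ++ x ∷ reverse (map aᶜ S)) ∷ʳ aᶜ e
Gʳ-∷ e S = trans (cong (λ as → map bᶜ (e ∷ S) ++ x ∷ as) (unfold-reverse (aᶜ e) (map aᶜ S)))
                 (sym (++-assoc (map bᶜ (e ∷ S)) (x ∷ reverse (map aᶜ S)) [ aᶜ e ]))

chain-head : ∀ f S {c r} → chain (f ∷ S) ≡ c ∷ r → c ≡ bᶜ f
chain-head f (_ ∷ _) refl = refl

-- A digram aᶜ g bᶜ g never occurs inside a reversed G (Gʳ-digramFree); at a phrase boundary only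
-- aᶜ e bᶜ e occurs, for the cell e already parsed, and e differs from all later cells.
chain-parse : ∀ {w} u e S → Unique (e ∷ S) → w ≡ u ++ chain (e ∷ S) → (∃ λ u′ → u ≡ u′ ∷ʳ aᶜ e) →
              All (λ g → DigramFree (aᶜ g) (bᶜ g) u) S → Factor (Gʳ (e ∷ S)) u → LZFrom w (length u) (length S)
chain-parse {w} u e [] _ w≡ _ _ _ = subst (λ i → LZFrom w i 0) (cong length (trans w≡ (++-identityʳ u))) done
chain-parse {w} u e (f ∷ S) ((e≢f ∷ e∉S) ∷ unique) w≡ (u′ , u≡) (free-f ∷ free-S) occ =
  phrase v (aᶜ f) V≡ w≡ (inj₂ (factor-++⁻ˡ V [ aᶜ e ] (subst (λ G → Factor G u) (Gʳ-∷ e (f ∷ S)) occ)))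
    (λ eq → subst (λ c → DigramFree (aᶜ f) c (u ++ V)) (sym (chain-head f S eq)) (keep f e≢f free-f))
    (chain-parse (u ++ V) f S unique (trans w≡ (sym (++-assoc u V _)))
      (u ++ v , trans (cong (u ++_) V≡) (sym (++-assoc u v [ aᶜ f ])))
      (All.zipWith (λ (e≢g , free-g) → keep _ e≢g free-g) (e∉S , free-S))
      (u ∷ʳ bᶜ e , [] , sym (trans (++-assoc u [ bᶜ e ] (Gʳ (f ∷ S) ++ [])) (cong (λ t → u ++ bᶜ e ∷ t) (++-identityʳ _)))))
  where
  V = bᶜ e ∷ Gʳ (f ∷ S)
  v = map bᶜ (e ∷ f ∷ S) ++ x ∷ reverse (map aᶜ S)
  V≡ : V ≡ v ∷ʳ aᶜ f
  V≡ = cong (bᶜ e ∷_) (Gʳ-∷ f S)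
  keep : ∀ g → e ≢ g → DigramFree (aᶜ g) (bᶜ g) u → DigramFree (aᶜ g) (bᶜ g) (u ++ V)
  keep g e≢g free-u = digramFree-++⁺ u free-u (Gʳ-digramFree g (e ∷ f ∷ S) (f ∷ S))
    λ y′ _ u≡y′ V≡bg → e≢g (cell-≡ (∷ʳ-injectiveʳ u′ y′ (trans (sym u≡) u≡y′)) (proj₁ (∷-injective V≡bg)))

-- The parse of T_p^R

link : List Cell → ℕ → Str
link S j = drop (length S ∸ suc j) (map bᶜ S) ++ x ∷ reverse (drop (length S ∸ j) (map aᶜ S))

link-∷ : ∀ e S {j} → j < length S → link S j ≡ link (e ∷ S) j
link-∷ e S j<S rewrite +-∸-assoc 1 (<⇒≤ j<S) | +-∸-assoc 1 j<S = refl

chain-link : ∀ S → chain S ≡ concatMap (link S) (desc (length S ∸ 1))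
chain-link []          = refl
chain-link (_ ∷ [])    = refl
chain-link (e ∷ f ∷ S) =
  cong₂ _++_ first (trans (chain-link (f ∷ S)) (concatMap-cong-desc (length S) (λ _ j≤S → link-∷ e (f ∷ S) (s≤s j≤S))))
  where
  first : bᶜ e ∷ Gʳ (f ∷ S) ≡ link (e ∷ f ∷ S) (suc (length S))
  first rewrite n∸n≡0 (length S) | m+n∸n≡m 1 (length S) = refl

G-top : ∀ p → G p (m p) ≡ 𝒜 p ++ x ∷ ℬ p
G-top p rewrite Equivalence.to T-≡ (≡⇒≡ᵇ (m p) (m p) refl) = refl

G-below : ∀ p {j} → j < m p → G p j ≡ drop (m p ∸ j) (𝒜 p) ++ x ∷ take (j + 1) (ℬ p)
G-below p {j} j<m with j ≡ᵇ m p in eq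
... | true  = contradiction (≡ᵇ⇒≡ j (m p) (Equivalence.from T-≡ eq)) (<⇒≢ j<m)
... | false = refl

m≡length-cells : ∀ p → m p ≡ length (cells p)
m≡length-cells p = trans (cong (_/ 2) (sym (length-cells p))) (m*n/n≡m (length (cells p)) 2)

TR-cells : ∀ p → TR (suc p) ≡ Gʳ (cells (suc p)) ++ chain (cells (suc p))
TR-cells p = begin
  reverse (concatMap (G P) (asc (m P)))                                    ≡⟨ reverse-concatMap (G P) (asc (m P)) ⟩
  concatMap (reverse ∘ G P) (reverse (asc (m P)))                          ≡⟨ cong (concatMap (reverse ∘ G P)) (reverse-involutive (desc (m P))) ⟩
  concatMap (reverse ∘ G P) (desc (m P))                                   ≡⟨ cong (concatMap (reverse ∘ G P) ∘ desc) (m≡length-cells P) ⟩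
  reverse (G P (length R)) ++ concatMap (reverse ∘ G P) (desc (length S))  ≡⟨ cong₂ _++_ top (concatMap-cong-desc (length S) below) ⟩
  Gʳ R ++ concatMap (link R) (desc (length S))                             ≡⟨ cong (Gʳ R ++_) (chain-link R) ⟨
  Gʳ R ++ chain R                                                          ∎
  where
  open ≡-Reasoning
  P = suc p
  R = cells P
  S = diagonal p 2 ++ cells p
  top : reverse (G P (length R)) ≡ Gʳ R
  top = begin
    reverse (G P (length R))           ≡⟨ cong (reverse ∘ G P) (m≡length-cells P) ⟨
    reverse (G P (m P))                ≡⟨ cong reverse (G-top P) ⟩
    reverse (𝒜 P ++ x ∷ ℬ P)           ≡⟨ reverse-++-∷ (𝒜 P) x (ℬ P) ⟩
    reverse (ℬ P) ++ x ∷ reverse (𝒜 P) ≡⟨ cong₂ (λ B A → B ++ x ∷ reverse A) (reverse-ℬ P) (sym (map-aᶜ-cells P)) ⟩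
    Gʳ R                               ∎
  below : ∀ {j} → 1 ≤ j → j ≤ length S → reverse (G P j) ≡ link R j
  below {j} _ j≤S = begin
    reverse (G P j)                                                        ≡⟨ cong reverse (G-below P (subst (j <_) (sym (m≡length-cells P)) (s≤s j≤S))) ⟩
    reverse (drop (m P ∸ j) (𝒜 P) ++ x ∷ take (j + 1) (ℬ P))               ≡⟨ reverse-++-∷ (drop (m P ∸ j) (𝒜 P)) x _ ⟩
    reverse (take (j + 1) (ℬ P)) ++ x ∷ reverse (drop (m P ∸ j) (𝒜 P))     ≡⟨ cong₂ (λ B n → B ++ x ∷ reverse (drop (n ∸ j) (𝒜 P))) b-part (m≡length-cells P) ⟩
    drop (length R ∸ suc j) (map bᶜ R) ++ x ∷ reverse (drop (length R ∸ j) (𝒜 P))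
                                                                           ≡⟨ cong (λ A → drop (length R ∸ suc j) (map bᶜ R) ++ x ∷ reverse (drop (length R ∸ j) A)) (map-aᶜ-cells P) ⟨
    link R j                                                               ∎
    where
    length-ℬ : length (ℬ P) ≡ length R
    length-ℬ = trans (sym (length-reverse (ℬ P))) (trans (cong length (reverse-ℬ P)) (length-map bᶜ R))
    b-part : reverse (take (j + 1) (ℬ P)) ≡ drop (length R ∸ suc j) (map bᶜ R)
    b-part = begin
      reverse (take (j + 1) (ℬ P))                ≡⟨ cong (λ k → reverse (take k (ℬ P))) (+-comm j 1) ⟩
      reverse (take (suc j) (ℬ P))                ≡⟨ drop-reverse (ℬ P) (suc j) ⟨
      drop (length (ℬ P) ∸ suc j) (reverse (ℬ P)) ≡⟨ cong₂ (λ n B → drop (n ∸ suc j) B) length-ℬ (reverse-ℬ P) ⟩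
      drop (length R ∸ suc j) (map bᶜ R)          ∎

Gʳ-cells : ∀ p → Gʳ (cells p) ≡ runs b (desc p) ++ x ∷ runs a (asc p)
Gʳ-cells p = cong₂ (λ B A → B ++ x ∷ A) (map-bᶜ-cells p) (reverse-map-aᶜ-cells p)

Gʳ-cells-parse : ∀ {w C n} p → w ≡ runs b (desc (suc p)) ++ x ∷ runs a (asc (suc p)) ++ C →
                 LZFrom w (length (runs b (desc (suc p)) ++ x ∷ runs a (asc (suc p)))) n →
                 LZFrom w 0 (suc p + (p + (2 + (p * 2 + n))))
Gʳ-cells-parse {w} {C} {n} p w≡ rest =
  run-parse b b-injective P w≡₁ (subst (λ i → LZFrom w i (p + (2 + (p * 2 + n)))) (cong length (++-identityʳ (run b P)))
    (descending-runs-parse b b-injective (λ _ ()) p P [] w≡₂ (n<1+n p ∷ [])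
      (fresh-phrase w≡ (∉-runs b (λ _ ()) (desc P))
        (fresh-phrase w≡₃ (no-a 1)
          (ascending-runs-parse a a-injective P no-a (trans w≡ (sym (∷ʳ-++ Bs x (As ++ C))))
            (subst (λ i → LZFrom w i n) (cong length (sym (∷ʳ-++ Bs x As))) rest) p refl)))))
  where
  P = suc p
  Bs = runs b (desc P)
  As = runs a (asc P)
  w≡₁ : w ≡ run b P ++ runs b (desc p) ++ x ∷ As ++ C
  w≡₁ = trans w≡ (++-assoc (run b P) (runs b (desc p)) _)
  w≡₂ : w ≡ runs b [ P ] ++ runs b (desc p) ++ x ∷ As ++ C
  w≡₂ = trans w≡₁ (cong (_++ runs b (desc p) ++ x ∷ As ++ C) (sym (++-identityʳ (run b P))))
  t = proj₁ (runs-asc-prefix a (s≤s (z≤n {p})))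
  w≡₃ : w ≡ Bs ∷ʳ x ++ a 1 ∷ t ++ C
  w≡₃ = trans w≡ (trans (cong (λ A′ → Bs ++ x ∷ A′ ++ C) (proj₂ (runs-asc-prefix a (s≤s (z≤n {p})))))
                        (sym (∷ʳ-++ Bs x (a 1 ∷ t ++ C))))
  no-a : ∀ i → a i ∉ Bs ∷ʳ x
  no-a i ai∈ with ∈-++⁻ Bs ai∈
  ... | inj₁ ai∈Bs = ∉-runs b (λ _ ()) (desc P) ai∈Bs
  ... | inj₂ (here ())

z-TR : ∀ p → z (TR (suc p)) ≡ suc p + (p + (2 + (p * 2 + length (diagonal p 2 ++ cells p))))
z-TR p = z-≡ (Gʳ-cells-parse p w≡ (subst (λ i → LZFrom (TR P) i (length S)) (cong length (Gʳ-cells P))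
  (chain-parse (Gʳ R) e S (unique-cells P) (TR-cells p) (map bᶜ R ++ x ∷ reverse (map aᶜ S) , Gʳ-∷ e S)
    (All.universal (λ g → Gʳ-digramFree g R R) S) ([] , [] , sym (++-identityʳ (Gʳ R))))))
  where
  P = suc p
  R = cells P
  e = (P , 1)
  S = diagonal p 2 ++ cells p
  w≡ : TR P ≡ runs b (desc P) ++ x ∷ runs a (asc P) ++ chain R
  w≡ = trans (TR-cells p) (trans (cong (_++ chain R) (Gʳ-cells P)) (++-assoc (runs b (desc P)) _ (chain R)))

lemma4p5 : (p : ℕ) → 1 ≤ p → 2 * z (TR p) + 4 ≡ p * p + 9 * p
lemma4p5 (suc p) _ = begin
  2 * z (TR (suc p)) + 4                          ≡⟨ cong (λ k → 2 * k + 4) (z-TR p) ⟩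
  2 * (suc p + (p + (2 + (p * 2 + L)))) + 4       ≡⟨ collect p L ⟩
  8 * p + 8 + suc L * 2                           ≡⟨ cong (8 * p + 8 +_) (length-cells (suc p)) ⟩
  8 * p + 8 + suc p * (suc p + 1)                 ≡⟨ expand p ⟩
  suc p * suc p + 9 * suc p                       ∎
  where
  open ≡-Reasoning
  L = length (diagonal p 2 ++ cells p)
  collect : ∀ p L → 2 * (suc p + (p + (2 + (p * 2 + L)))) + 4 ≡ 8 * p + 8 + suc L * 2
  collect = solve-∀
  expand : ∀ p → 8 * p + 8 + suc p * (suc p + 1) ≡ suc p * suc p + 9 * suc p
  expand = solve-∀
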